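{- Let $G$ be a looped simple graph and let $T \in \mathcal{T}(G)$ be a transversal of $W(G)$. Then there exist a looped simple graph $H$ locally equivalent to $G$, an induced isomorphism $\beta: M[IAS(G)] \to M[IAS(H)]$, and a stable set $X$ of $H$ such that $\beta(T) = T_H(X)$; that is, $\beta$ maps the transverse matroid $M[IAS(G)]\mid T$ isomorphically onto the neighborhood matroid $M_H(X)$ of the stable set $X$ of $H$.
   Context: A looped simple graph is a finite graph in which loops are allowed but no two edges have the same set of end-vertices. "Adjacent"/"neighbors" refer only to distinct vertices; $N_G(v)$ is the open neighborhood of $v$ (not containing $v$). $A(G)$ is the $V(G)\times V(G)$ adjacency matrix over $GF(2)$, with diagonal entry $1$ exactly at looped vertices. $IAS(G)$ is the $GF(2)$-matrix $(I \; A(G) \; A(G)+I)$; for $v\in V(G)$ the $v$ columns of $I$, $A(G)$, $A(G)+I$ are labeled $\phi_G(v)$, $\chi_G(v)$, $\psi_G(v)$. $W(G)$ is the set of these $3|V(G)|$ labels and the isotropic matroid $M[IAS(G)]$ is the binary matroid on $W(G)$ represented by $IAS(G)$. The vertex triple of $v$ is $\tau_G(v)=\{\phi_G(v),\chi_G(v),\psi_G(v)\}$. A subtransversal is a subset of $W(G)$ containing at most one element of each vertex triple; a transversal contains exactly one; $\mathcal{S}(G)$, $\mathcal{T}(G)$ denote these families. A transverse matroid of $G$ is $M[IAS(G)]\mid T$ for $T\in\mathcal{T}(G)$. Local equivalence: for $v \in V(G)$, $G^v_\ell$ complements the loop status of $v$; $G^v_s$ complements the adjacency status of every pair of distinct neighbors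 of $v$; $G^v_{ns}$ does the same and also complements the loop status of every neighbor of $v$. $H$ is locally equivalent to $G$ if $H$ is obtained from $G$ by a finite sequence of such operations (so $V(H)=V(G)$). For $*\in\{\ell,s,ns\}$ there is an isomorphism $\beta^v_*: M[IAS(G)]\to M[IAS(G^v_*)]$ with $\beta^v_*(\alpha_G(x))=\alpha_{G^v_*}(x)$ for all $\alpha\in\{\phi,\chi,\psi\}$, $x\in V(G)$, except: $\beta^v_\ell$ swaps $\chi(v)$ and $\psi(v)$; $\beta^v_{ns}$ sends $\phi_G(v)\mapsto\psi(v)$, $\psi_G(v)\mapsto \phi(v)$ if $v$ is unlooped, and $\phi_G(v)\mapsto\chi(v)$, $\chi_G(v)\mapsto\phi(v)$ if $v$ is looped; $\beta^v_s$ has the same exceptions at $v$ as $\beta^v_{ns}$ and additionally, for each $w\in N_G(v)$, $\chi_G(w)\mapsto \psi(w)$ and $\psi_G(w)\mapsto\chi(w)$. An induced isomorphism $M[IAS(G)]\to M[IAS(H)]$ is a composition of such maps along a sequence of these operations transforming $G$ into $H$. A set $X\subseteq V(G)$ is stable if no two elements are neighbors. For a stable set $X$ of $H$, $T_H(X)=\{\phi_H(v)\mid v\notin X\}\cup\{\chi_H(x)\mid x\in X \text{ unlooped}\}\cup\{\psi_H(x)\mid x\in X\text{ looped}\}$, a transversal, and the neighborhood matroid is $M_H(X)=M[IAS(H)]\mid T_H(X)$. -}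

module Defs where

open import Data.Bool using (Bool; true; false; not; _∧_; if_then_else_)
open import Data.Fin using (Fin; _≟_)
open import Data.Nat using (ℕ)
open import Data.List using (List; []; _∷_)
open import Data.Product using (_×_; _,_)
open import Relation.Nullary using (yes; no; ¬_)
open import Relation.Nullary.Decidable using (⌊_⌋)
open import Relation.Binary.PropositionalEquality using (_≡_)

-- A (looped) graph on vertex set Fin n, given by its GF(2) adjacency
-- matrix A(G): A v w = true iff v,w adjacent (v ≢ w), A v v = true iff v looped.
Adj : ℕ → Set
Adj n = Fin n → Fin n → Bool

IsLoopedSimple : ∀ {n} → Adj n → Set
IsLoopedSimple G = ∀ x y → G x y ≡ G y x

eqb : ∀ {n} → Fin n → Fin n → Bool
eqb x y = ⌊ x ≟ y ⌋

nbr : ∀ {n} → Adj n → Fin n → Fin n → Bool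
nbr G v w = not (eqb v w) ∧ G v w

data LocalOp (n : ℕ) : Set where
  opℓ  : Fin n → LocalOp n
  ops  : Fin n → LocalOp n
  opns : Fin n → LocalOp n

applyOp : ∀ {n} → LocalOp n → Adj n → Adj n
applyOp (opℓ v) G x y = if eqb x v ∧ eqb y v then not (G x y) else G x y
applyOp (ops v) G x y =
  if not (eqb x y) ∧ (nbr G v x ∧ nbr G v y) then not (G x y) else G x y
applyOp (opns v) G x y =
  if nbr G v x ∧ nbr G v y then not (G x y) else G x y

applySeq : ∀ {n} → List (LocalOp n) → Adj n → Adj n
applySeq [] G = G
applySeq (o ∷ os) G = applySeq os (applyOp o G)

-- labels of W(G): φ(v), χ(v), ψ(v)
data Kind : Set where
  φ χ ψ : Kind

Label : ℕ → Set
Label n = Kind × Fin n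

swapχψ : Kind → Kind
swapχψ φ = φ
swapχψ χ = ψ
swapχψ ψ = χ

swapφψ : Kind → Kind
swapφψ φ = ψ
swapφψ χ = χ
swapφψ ψ = φ

swapφχ : Kind → Kind
swapφχ φ = χ
swapφχ χ = φ
swapφχ ψ = ψ

-- exceptional behaviour at v of β^v_ns and β^v_s (depends on loop status of v in G)
atV : ∀ {n} → Adj n → Fin n → Kind → Kind
atV G v k = if G v v then swapφχ k else swapφψ k

βop : ∀ {n} → LocalOp n → Adj n → Label n → Label n
βop (opℓ v) G (k , x) = (if eqb x v then swapχψ k else k) , x
βop (opns v) G (k , x) = (if eqb x v then atV G v k else k) , x
βop (ops v) G (k , x) =
  (if eqb x v then atV G v k else (if nbr G v x then swapχψ k else k)) , x

-- induced isomorphism M[IAS(G)] → M[IAS(applySeq os G)], as a map on labels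
βseq : ∀ {n} → List (LocalOp n) → Adj n → Label n → Label n
βseq [] G l = l
βseq (o ∷ os) G l = βseq os (applyOp o G) (βop o G l)

IsStable : ∀ {n} → Adj n → (Fin n → Bool) → Set
IsStable H X = ∀ x y → X x ≡ true → X y ≡ true → ¬ (x ≡ y) → H x y ≡ false

TH : ∀ {n} → Adj n → (Fin n → Bool) → Fin n → Kind
TH H X v = if X v then (if H v v then ψ else χ) else φ

-- membership of a label in the transversal given by t : Fin n → Kind
-- (a transversal T ∈ 𝒯(G) is exactly {(t v , v) | v} for a unique t)
_∈T_ : ∀ {n} → Label n → (Fin n → Kind) → Set
(k , v) ∈T t = k ≡ t v

module Submission where

-- Record the image of the transversal t after a sequence of
-- ns-moves by a kind assignment c : Fin n → Kind (every induced map fixes the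
-- vertex of a label, so this is all the information).  Call c *normal* for a
-- graph H when (1) each kind matches its vertex as T_H(X) would choose it
-- (φ anywhere, χ only at unlooped, ψ only at looped vertices) and (2) the
-- vertices of non-φ kind form a stable set X; then c is exactly T_H(X).
-- Two ns-moves reduce any c to a normal one:
--   * repair:   if c v does not match v, the move G^v_ns turns c v into φ and
--               fixes every other kind, so the support {w | c w ≢ φ} shrinks;
--   * separate: if c matches everywhere but two adjacent vertices x, y both
--               carry non-φ kinds, the move G^x_ns fixes every kind and
--               toggles the loop of y, so y becomes mismatched and is repaired.
-- Well-founded recursion on the support (ordered by strict inclusion) yields a
-- normal form; the theorem then reads it off.

open import Defs
open import Data.Nat using (ℕ)
open import Data.Bool using (Bool; true; false; not; if_then_else_)
open import Data.Bool.Properties using () renaming (_≟_ to _≟ᵇ_)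
open import Data.Fin using (Fin; _≟_)
open import Data.Fin.Properties using (all?; any?; ¬∀⟶∃¬)
open import Data.Fin.Subset using (Subset; _⊂_; _∈_)
open import Data.Fin.Subset.Induction using (⊂-wellFounded)
open import Data.Vec using (tabulate)
open import Data.Vec.Properties using (lookup⇒[]=; []=⇒lookup; lookup∘tabulate)
open import Data.List using (List; []; _∷_)
open import Data.Sum using (_⊎_; inj₁; inj₂)
open import Data.Product using (Σ; _×_; _,_)
open import Induction.WellFounded using (Acc; acc)
open import Relation.Nullary using (¬_; yes; no; contradiction)
open import Relation.Nullary.Decidable using (Dec; _×-dec_; ¬?)
open import Relation.Binary.PropositionalEquality
  using (_≡_; _≢_; refl; sym; trans; cong; subst)

-- `Matches b k`: kind k is the one T_H(X) may select at a vertex of loop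
-- status b (φ always; χ at an unlooped, ψ at a looped vertex of X).
data Matches : Bool → Kind → Set where
  φ-matches : ∀ {b} → Matches b φ
  χ-matches : Matches false χ
  ψ-matches : Matches true ψ

matches? : ∀ b k → Dec (Matches b k)
matches? b     φ = yes φ-matches
matches? false χ = yes χ-matches
matches? true  χ = no λ ()
matches? false ψ = no λ ()
matches? true  ψ = yes ψ-matches

nonφ : Kind → Bool
nonφ φ = false
nonφ χ = true
nonφ ψ = true

-- the vertex exchange of β^v_ns at v, as a function of the loop status b of v
exchange : Bool → Kind → Kind
exchange b k = if b then swapφχ k else swapφψ k

mismatch⇒nonφ : ∀ b k → ¬ Matches b k → nonφ k ≡ true
mismatch⇒nonφ b φ bad = contradiction φ-matches bad
mismatch⇒nonφ b χ bad = refl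
mismatch⇒nonφ b ψ bad = refl

mismatch⇒exchange-φ : ∀ b k → ¬ Matches b k → exchange b k ≡ φ
mismatch⇒exchange-φ b     φ bad = contradiction φ-matches bad
mismatch⇒exchange-φ false χ bad = contradiction χ-matches bad
mismatch⇒exchange-φ true  χ bad = refl
mismatch⇒exchange-φ false ψ bad = refl
mismatch⇒exchange-φ true  ψ bad = contradiction ψ-matches bad

matching⇒exchange-fixed : ∀ {b k} → Matches b k → nonφ k ≡ true → exchange b k ≡ k
matching⇒exchange-fixed χ-matches _ = refl
matching⇒exchange-fixed ψ-matches _ = refl

matching⇒toggled-mismatch : ∀ {b k} → Matches b k → nonφ k ≡ true → ¬ Matches (not b) k
matching⇒toggled-mismatch χ-matches _ ()
matching⇒toggled-mismatch ψ-matches _ ()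

matching⇒chosen : ∀ {b k} → Matches b k →
  k ≡ (if nonφ k then (if b then ψ else χ) else φ)
matching⇒chosen φ-matches = refl
matching⇒chosen χ-matches = refl
matching⇒chosen ψ-matches = refl

eqb-refl : ∀ {n} (v : Fin n) → eqb v v ≡ true
eqb-refl v with v ≟ v
... | yes _  = refl
... | no v≢v = contradiction refl v≢v

eqb-distinct : ∀ {n} {w v : Fin n} → w ≢ v → eqb w v ≡ false
eqb-distinct {w = w} {v} w≢v with w ≟ v
... | yes w≡v = contradiction w≡v w≢v
... | no _    = refl

ns-toggles-loop : ∀ {n} (H : Adj n) {x y} → x ≢ y → H x y ≡ true →
  applyOp (opns x) H y y ≡ not (H y y)
ns-toggles-loop H x≢y xy rewrite eqb-distinct x≢y | xy = refl

support : ∀ {n} → (Fin n → Kind) → Subset n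
support c = tabulate (λ w → nonφ (c w))

∈-support : ∀ {n} (c : Fin n → Kind) {w} → nonφ (c w) ≡ true → w ∈ support c
∈-support c {w} nw = lookup⇒[]= w (support c) (trans (lookup∘tabulate _ w) nw)

∈-support⁻ : ∀ {n} (c : Fin n → Kind) {w} → w ∈ support c → nonφ (c w) ≡ true
∈-support⁻ c {w} w∈ = trans (sym (lookup∘tabulate _ w)) ([]=⇒lookup w∈)

clear : ∀ {n} → (Fin n → Kind) → Fin n → Fin n → Kind
clear c v w = if eqb w v then φ else c w

clear-at : ∀ {n} (c : Fin n → Kind) v → clear c v v ≡ φ
clear-at c v rewrite eqb-refl v = refl

clear-away : ∀ {n} (c : Fin n → Kind) {v w} → w ≢ v → clear c v w ≡ c w
clear-away c w≢v rewrite eqb-distinct w≢v = refl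

clear-shrinks : ∀ {n} (c : Fin n → Kind) v → nonφ (c v) ≡ true →
  support (clear c v) ⊂ support c
clear-shrinks c v nv = shrink , v , ∈-support c nv , v∉
  where
    cleared : nonφ (clear c v v) ≢ true
    cleared rewrite clear-at c v = λ ()
    v∉ : ¬ v ∈ support (clear c v)
    v∉ v∈ = cleared (∈-support⁻ (clear c v) v∈)
    shrink : ∀ {w} → w ∈ support (clear c v) → w ∈ support c
    shrink {w} w∈ with w ≟ v
    ... | yes refl = contradiction w∈ v∉
    ... | no w≢v   = ∈-support c
                       (subst (λ k → nonφ k ≡ true) (clear-away c w≢v) (∈-support⁻ (clear c v) w∈))

-- c is normal for H when it is T_H(X) for the stable set X of its support.
record Normal {n} (H : Adj n) (c : Fin n → Kind) : Set where
  field
    matching : ∀ v → Matches (H v v) (c v)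
    stable   : IsStable H (λ v → nonφ (c v))

Clash : ∀ {n} → Adj n → (Fin n → Kind) → Fin n → Fin n → Set
Clash H c x y = nonφ (c x) ≡ true × nonφ (c y) ≡ true × x ≢ y × H x y ≡ true

data Defect {n} (H : Adj n) (c : Fin n → Kind) : Set where
  mismatch : ∀ v → ¬ Matches (H v v) (c v) → Defect H c
  clash    : ∀ x y → Matches (H x x) (c x) → Matches (H y y) (c y) →
             Clash H c x y → Defect H c

clash? : ∀ {n} (H : Adj n) c x y → Dec (Clash H c x y)
clash? H c x y = (nonφ (c x) ≟ᵇ true) ×-dec (nonφ (c y) ≟ᵇ true)
                   ×-dec ¬? (x ≟ y) ×-dec (H x y ≟ᵇ true)

classify : ∀ {n} (H : Adj n) c → Normal H c ⊎ Defect H c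
classify {n} H c with all? (λ v → matches? (H v v) (c v))
... | no ¬all = let (v , bad) = ¬∀⟶∃¬ n _ (λ v → matches? (H v v) (c v)) ¬all
                in inj₂ (mismatch v bad)
... | yes all with any? (λ x → any? (λ y → clash? H c x y))
...   | yes (x , y , cl) = inj₂ (clash x y (all x) (all y) cl)
...   | no ¬clash = inj₁ record { matching = all ; stable = stable }
  where
    stable : IsStable H (λ v → nonφ (c v))
    stable x y nx ny x≢y with H x y in xy
    ... | false = refl
    ... | true  = contradiction (x , y , nx , ny , x≢y , xy) ¬clash

Reachable : ∀ {n} → Adj n → (Fin n → Kind) → Set
Reachable {n} H c = Σ (List (LocalOp n)) λ os → Σ (Fin n → Kind) λ c′ →
  (∀ w → βseq os H (c w , w) ≡ (c′ w , w)) × Normal (applySeq os H) c′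

move : ∀ {n} (o : LocalOp n) (H : Adj n) {c c₁ : Fin n → Kind} →
  (∀ w → βop o H (c w , w) ≡ (c₁ w , w)) → Reachable (applyOp o H) c₁ → Reachable H c
move o H o-c≡c₁ (os , c′ , os-c₁≡c′ , normal) =
  o ∷ os , c′ , (λ w → trans (cong (βseq os (applyOp o H)) (o-c≡c₁ w)) (os-c₁≡c′ w)) , normal

repair : ∀ {n} (H : Adj n) c v → ¬ Matches (H v v) (c v) →
  Reachable (applyOp (opns v) H) (clear c v) → Reachable H c
repair H c v bad = move (opns v) H carries
  where
    carries : ∀ w → βop (opns v) H (c w , w) ≡ (clear c v w , w)
    carries w with w ≟ v
    ... | yes refl = cong (_, w) (mismatch⇒exchange-φ (H w w) (c w) bad)
    ... | no _     = refl

separate : ∀ {n} (H : Adj n) c x → Matches (H x x) (c x) → nonφ (c x) ≡ true →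
  Reachable (applyOp (opns x) H) c → Reachable H c
separate H c x mx nx = move (opns x) H fixes
  where
    fixes : ∀ w → βop (opns x) H (c w , w) ≡ (c w , w)
    fixes w with w ≟ x
    ... | yes refl = cong (_, w) (matching⇒exchange-fixed mx nx)
    ... | no _     = refl

separated-mismatch : ∀ {n} (H : Adj n) c x y → Matches (H y y) (c y) → Clash H c x y →
  ¬ Matches (applyOp (opns x) H y y) (c y)
separated-mismatch H c x y my (_ , ny , x≢y , xy) rewrite ns-toggles-loop H x≢y xy =
  matching⇒toggled-mismatch my ny

normalise : ∀ {n} (H : Adj n) c → Acc _⊂_ (support c) → Reachable H c
normalise H c (acc smaller) with classify H c
... | inj₁ normal = [] , c , (λ _ → refl) , normal
... | inj₂ (mismatch v bad) =
  repair H c v bad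
    (normalise _ _ (smaller (clear-shrinks c v (mismatch⇒nonφ _ _ bad))))
... | inj₂ (clash x y mx my cl@(nx , ny , _)) =
  separate H c x mx nx
    (repair H′ c y bad (normalise _ _ (smaller (clear-shrinks c y ny))))
  where
    H′ = applyOp (opns x) H
    bad : ¬ Matches (H′ y y) (c y)
    bad = separated-mismatch H c x y my cl

normal⇒transversal : ∀ {n} (β : Label n → Label n) (H : Adj n) (t c : Fin n → Kind) →
  (∀ w → β (t w , w) ≡ (c w , w)) → (∀ v → Matches (H v v) (c v)) →
  let X = λ v → nonφ (c v) in
  (∀ l → l ∈T t → β l ∈T TH H X)
  × (∀ l → l ∈T TH H X → Σ (Label n) λ m → (m ∈T t) × (β m ≡ l))
normal⇒transversal {n} β H t c β≡ matching = forward , backward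
  where
    chosen : ∀ v → c v ≡ TH H (λ v → nonφ (c v)) v
    chosen v = matching⇒chosen (matching v)
    forward : ∀ l → l ∈T t → β l ∈T TH H (λ v → nonφ (c v))
    forward (_ , v) refl = subst (_∈T TH H (λ v → nonφ (c v))) (sym (β≡ v)) (chosen v)
    backward : ∀ l → l ∈T TH H (λ v → nonφ (c v)) → Σ (Label n) λ m → (m ∈T t) × (β m ≡ l)
    backward (k , v) k≡ = (t v , v) , refl , trans (β≡ v) (cong (_, v) (trans (chosen v) (sym k≡)))

theorem4 : (n : ℕ) (G : Adj n) → IsLoopedSimple G → (t : Fin n → Kind) →
    Σ (List (LocalOp n)) λ os → Σ (Fin n → Bool) λ X →
      IsStable (applySeq os G) X
      × (∀ (l : Label n) → l ∈T t → βseq os G l ∈T TH (applySeq os G) X)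
      × (∀ (l : Label n) → l ∈T TH (applySeq os G) X →
           Σ (Label n) λ m → (m ∈T t) × (βseq os G m ≡ l))
theorem4 n G _ t with normalise G t (⊂-wellFounded (support t))
... | os , c , β≡ , normal =
  os , (λ v → nonφ (c v)) , Normal.stable normal ,
  normal⇒transversal (βseq os G) (applySeq os G) t c β≡ (Normal.matching normal)
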